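{- Let $S$ be a set and $\mathcal{O}$ an operator on $S$. The greatest operator $\mathcal{R}$ on $S$ with $\mathcal{O}\triangleleft\mathcal{R}$ is the constant operator whose value is the largest subset of $S$ that splits $\mathcal{O}$ (namely the union of all subsets of $S$ that split $\mathcal{O}$).
   Context: All reasoning is intuitionistic (no law of excluded middle); impredicative constructions allowed. An operator on $S$ is any map $\mathrm{Pow}(S)\to\mathrm{Pow}(S)$; operators are ordered by pointwise inclusion. For $U,V\subseteq S$, $U\between V$ means there exists $a\in U\cap V$. $\mathcal{O}\triangleleft\mathcal{O}'$ means: for all $U,V\subseteq S$, $\mathcal{O}(U)\between\mathcal{O}'(V)$ implies $U\between\mathcal{O}'(V)$. A subset $Z\subseteq S$ splits $\mathcal{O}$ if for all $U\subseteq S$, $\mathcal{O}(U)\between Z$ implies $U\between Z$. The greatest operator right-compatible with $\mathcal{O}$ exists, and a union of subsets splitting $\mathcal{O}$ splits $\mathcal{O}$. -}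

module Defs where

open import Level using (Level; _⊔_; suc)
open import Data.Product using (Σ; _×_; _,_)
open import Relation.Unary using (Pred; _⊆_)

Op : ∀ {a} ℓ → Set a → Set (a ⊔ suc ℓ)
Op ℓ S = Pred S ℓ → Pred S ℓ

_≤Op_ : ∀ {a ℓ} {S : Set a} → Op ℓ S → Op ℓ S → Set (a ⊔ suc ℓ)
O ≤Op O' = ∀ U → O U ⊆ O' U

_≬_ : ∀ {a ℓ} {S : Set a} → Pred S ℓ → Pred S ℓ → Set (a ⊔ ℓ)
U ≬ V = Σ _ (λ x → U x × V x)

_◁_ : ∀ {a ℓ} {S : Set a} → Op ℓ S → Op ℓ S → Set (a ⊔ suc ℓ)
O ◁ O' = ∀ U V → O U ≬ O' V → U ≬ O' V

Splits : ∀ {a ℓ} {S : Set a} → Op ℓ S → Pred S ℓ → Set (a ⊔ suc ℓ)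
Splits O Z = ∀ U → O U ≬ Z → U ≬ Z

IsGreatestRightCompatible : ∀ {a ℓ} {S : Set a} → Op ℓ S → Op ℓ S → Set (a ⊔ suc ℓ)
IsGreatestRightCompatible O R = (O ◁ R) × (∀ R' → O ◁ R' → R' ≤Op R)

IsLargestSplitting : ∀ {a ℓ} {S : Set a} → Op ℓ S → Pred S ℓ → Set (a ⊔ suc ℓ)
IsLargestSplitting O Z = Splits O Z × (∀ Z' → Splits O Z' → Z' ⊆ Z)

constOp : ∀ {a ℓ} {S : Set a} → Pred S ℓ → Op ℓ S
constOp Z = λ _ → Z

{-# OPTIONS --safe #-}
module Submission where

open import Defs
open import Relation.Unary using (Pred)
open import Data.Product using (_,_)

-- O ◁ R says precisely that every value R(V) splits O; so a constant operator
-- is compatible iff its value splits, and any compatible R has all its values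
-- inside the largest splitting subset.

module _ {a ℓ} {S : Set a} (O : Op ℓ S) where

  splits⇒◁-constOp : ∀ {Z : Pred S ℓ} → Splits O Z → O ◁ constOp Z
  splits⇒◁-constOp splits U _ = splits U

  ◁⇒splits-values : ∀ {R : Op ℓ S} → O ◁ R → ∀ V → Splits O (R V)
  ◁⇒splits-values compatible V U = compatible U V

proposition1p8 : ∀ {a ℓ} {S : Set a} (O : Op ℓ S) (Z : Pred S ℓ) →
    IsLargestSplitting O Z → IsGreatestRightCompatible O (constOp Z)
proposition1p8 O Z (splits , largest) =
  splits⇒◁-constOp O splits ,
  λ R compatible V → largest (R V) (◁⇒splits-values O compatible V)
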